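{- Let $k\ge 2$, let $G$ be a graph with minimum degree at least $k$, and let $L=(P,C)$ be an optimal lollipop of $G$ with $C=c_1\dots c_tc_1$ and $c_1$ the common vertex of $P$ and $C$. If $G[V(C)]$ contains a Hamiltonian path with ends $c_1$ and $u$, then $N_G(u)\subseteq V(C)$.
   Context: All graphs are finite and simple. A path is a sequence $p_1\dots p_s$ of distinct vertices with consecutive vertices adjacent; a cycle is a sequence $c_1\dots c_t c_1$ ($t\ge 3$) of distinct vertices with consecutive vertices (indices mod $t$) adjacent; its length is its number of edges. A lollipop in $G$ is a pair $L=(P,C)$ where $P=p_1\dots p_s$ ($s\geq 1$) is a path of $G$, $C=c_1\dots c_tc_1$ ($t\geq 3$) is a cycle of $G$, $p_s=c_1$ and $V(P)\cap V(C)=\{c_1\}$; $V(L)=V(P)\cup V(C)$. A lollipop $L=(P,C)$ is optimal if (1) no lollipop $L'$ of $G$ satisfies $V(L)\subsetneq V(L')$, and (2) no lollipop $L'=(P',C')$ of $G$ with $V(L')=V(L)$ has $C'$ longer than $C$. $N_G(u)$ is the set of neighbors of $u$ in $G$. -}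

module Defs where

open import Data.Nat using (ℕ; _≤_; _<_; _+_)
open import Data.Bool using (Bool; true; false; if_then_else_)
open import Data.Fin using (Fin)
open import Data.List using (List; []; _∷_; length; map; allFin)
open import Data.Nat.ListAction using (sum)
open import Data.List.Membership.Propositional using (_∈_)
open import Data.List.Relation.Unary.Unique.Propositional using (Unique)
open import Data.List.Relation.Unary.Linked using (Linked)
open import Data.Product using (_×_; ∃)
open import Data.Sum using (_⊎_)
open import Relation.Nullary using (¬_)
open import Relation.Binary.PropositionalEquality using (_≡_)

record Graph (n : ℕ) : Set where
  field
    edge   : Fin n → Fin n → Bool
    sym    : ∀ u v → edge u v ≡ edge v u
    irrefl : ∀ v → edge v v ≡ false

module _ {n : ℕ} (G : Graph n) where
  open Graph G

  Adj : Fin n → Fin n → Set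
  Adj u v = edge u v ≡ true

  degree : Fin n → ℕ
  degree v = sum (map (λ w → if edge v w then 1 else 0) (allFin n))

  MinDegreeAtLeast : ℕ → Set
  MinDegreeAtLeast k = ∀ v → k ≤ degree v

lastOf : {A : Set} → A → List A → A
lastOf x []       = x
lastOf x (y ∷ ys) = lastOf y ys

module _ {n : ℕ} (G : Graph n) where

  record Path : Set where
    constructor mkPath
    field
      first  : Fin n
      rest   : List (Fin n)
      unique : Unique (first ∷ rest)
      linked : Linked (Adj G) (first ∷ rest)

  pverts : Path → List (Fin n)
  pverts P = Path.first P ∷ Path.rest P

  pend : Path → Fin n
  pend P = lastOf (Path.first P) (Path.rest P)

  record Cycle : Set where
    constructor mkCycle
    field
      first   : Fin n
      rest    : List (Fin n)
      long    : 3 ≤ length (first ∷ rest)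
      unique  : Unique (first ∷ rest)
      linked  : Linked (Adj G) (first ∷ rest)
      closing : Adj G (lastOf first rest) first

  cverts : Cycle → List (Fin n)
  cverts C = Cycle.first C ∷ Cycle.rest C

  -- length of a cycle = number of edges = t
  clength : Cycle → ℕ
  clength C = length (cverts C)

  record Lollipop : Set where
    constructor mkLollipop
    field
      path    : Path
      cycle   : Cycle
      joined  : pend path ≡ Cycle.first cycle
      disjoint : ∀ v → v ∈ pverts path → v ∈ cverts cycle → v ≡ Cycle.first cycle

  InL : Lollipop → Fin n → Set
  InL L v = v ∈ pverts (Lollipop.path L) ⊎ v ∈ cverts (Lollipop.cycle L)

  StrictSub : Lollipop → Lollipop → Set
  StrictSub L L' = (∀ v → InL L v → InL L' v) × ∃ (λ v → InL L' v × ¬ InL L v)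

  SameVerts : Lollipop → Lollipop → Set
  SameVerts L L' = (∀ v → InL L v → InL L' v) × (∀ v → InL L' v → InL L v)

  record Optimal (L : Lollipop) : Set where
    field
      maximal : ∀ L' → ¬ StrictSub L L'
      longest : ∀ L' → SameVerts L L' →
                ¬ (clength (Lollipop.cycle L) < clength (Lollipop.cycle L'))

  -- a Hamiltonian path of G[V(C)] with ends a and b (edges of G[V(C)]
  -- are exactly the edges of G between vertices of C)
  record HamPathInCycleVerts (C : Cycle) (a b : Fin n) : Set where
    field
      hp      : Path
      inside  : ∀ v → v ∈ pverts hp → v ∈ cverts C
      covers  : ∀ v → v ∈ cverts C → v ∈ pverts hp
      starts  : Path.first hp ≡ a
      ends    : pend hp ≡ b

-- Let X be the tour of L: the stem P followed by the Hamiltonian path of G[V(C)] from c₁.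
-- It is a path through all of V(L) ending at u.  Suppose u has a neighbour w outside V(C).
-- If w lies on P, the edge uw closes the part of X from w onwards into a cycle through w
-- and all of V(C); with the part of P before w this is a lollipop on V(L) whose cycle is
-- longer than C.  Otherwise X w is a path leaving V(L).  As every vertex has degree at
-- least 2, the end of such a path always has a neighbour other than its predecessor:
-- either it lies on the path, closing a lollipop, or the path can be extended by it.
-- Hence X w lies in a lollipop, which strictly contains V(L).
module Submission where

open import Defs
open import Data.Nat using (ℕ; _≤_; _<_; _+_; suc; s≤s; s≤s⁻¹; z≤n)
open import Data.Nat.Properties using (≤-trans; m≤n⇒m≤1+n; <⇒≱; +-assoc; +-identityʳ; m≤n+m)
open import Data.Fin using (Fin; _≟_)
open import Data.Bool using (true; false; if_then_else_)
open import Data.List using (List; []; _∷_; _++_; _∷ʳ_; length; map; allFin; initLast; _∷ʳ′_)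
open import Data.List.Properties using (++-assoc; ∷ʳ-++; length-++; length-++-sucʳ; length-++-≤ʳ; length-tabulate)
open import Data.Nat.ListAction using (sum)
open import Data.List.Membership.Propositional using (_∈_; _∉_)
open import Data.List.Membership.Propositional.Properties using (∈-++⁺ˡ; ∈-++⁺ʳ; ∈-++⁻; ∈-∃++; ∈-allFin)
open import Data.List.Relation.Binary.Subset.Propositional using (_⊆_)
open import Data.List.Relation.Binary.Disjoint.Propositional using (Disjoint)
open import Data.List.Relation.Unary.Any using (here; there; any?)
open import Data.List.Relation.Unary.All using ([])
import Data.List.Relation.Unary.All as All
import Data.List.Relation.Unary.All.Properties as All
open import Data.List.Relation.Unary.All.Properties using (¬Any⇒All¬)
open import Data.List.Relation.Unary.AllPairs using ([]; _∷_)
import Data.List.Relation.Unary.AllPairs as AllPairs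
open import Data.List.Relation.Unary.Unique.Propositional using (Unique)
open import Data.List.Relation.Unary.Unique.Propositional.Properties
  using (++⁺; allFin⁺; Unique[x∷xs]⇒x∉xs)
open import Data.List.Relation.Unary.Linked using (Linked; []; [-]; _∷_)
import Data.List.Relation.Unary.Linked as Linked
open import Data.Product using (_×_; _,_; ∃; Σ; proj₁; proj₂; map₂)
open import Data.Sum using (inj₁; inj₂; [_,_])
open import Data.Empty using (⊥-elim)
open import Function using (_∘_)
open import Function.Bundles using (_⇔_; mk⇔; Equivalence)
open import Relation.Nullary using (¬_; yes; no)
open import Relation.Binary.PropositionalEquality using (_≡_; _≢_; refl; sym; trans; cong; subst)

open Equivalence using (to; from)

module _ {A : Set} where

  lastOf-++ : ∀ (x : A) xs ys → lastOf x (xs ++ ys) ≡ lastOf (lastOf x xs) ys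
  lastOf-++ x []       ys = refl
  lastOf-++ x (y ∷ xs) ys = lastOf-++ y xs ys

  lastOf-∈ : ∀ (x : A) xs → lastOf x xs ∈ x ∷ xs
  lastOf-∈ x []       = here refl
  lastOf-∈ x (y ∷ xs) = there (lastOf-∈ y xs)

  lastOf-cong-++ : ∀ {x y : A} {xs} as {ys} → x ∷ xs ≡ as ++ y ∷ ys → lastOf x xs ≡ lastOf y ys
  lastOf-cong-++ []       refl = refl
  lastOf-cong-++ (a ∷ as) {ys} refl = lastOf-++ a as (_ ∷ ys)

  2≤length-∷ʳ-∷ʳ : ∀ (xs : List A) x y → 2 ≤ length (xs ∷ʳ x ∷ʳ y)
  2≤length-∷ʳ-∷ʳ []       x y = s≤s (s≤s z≤n)
  2≤length-∷ʳ-∷ʳ (_ ∷ xs) x y = m≤n⇒m≤1+n (2≤length-∷ʳ-∷ʳ xs x y)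

  Unique-++⁻ : ∀ (xs : List A) {ys} → Unique (xs ++ ys) → Unique xs × Unique ys × Disjoint xs ys
  Unique-++⁻ []       u = [] , u , λ ()
  Unique-++⁻ (x ∷ xs) (x∉ ∷ u) with Unique-++⁻ xs u
  ... | uxs , uys , disjoint =
    All.++⁻ˡ xs x∉ ∷ uxs , uys , λ where
      (here refl , v∈ys) → All.lookup (All.++⁻ʳ xs x∉) v∈ys refl
      (there v∈xs , v∈ys) → disjoint (v∈xs , v∈ys)

  Unique-∷ʳ : ∀ {xs} {y : A} → Unique xs → y ∉ xs → Unique (xs ∷ʳ y)
  Unique-∷ʳ uxs y∉xs = ++⁺ uxs ([] ∷ []) λ where (y∈xs , here refl) → y∉xs y∈xs

  Unique⇒length-≤ : ∀ {xs ys : List A} → Unique xs → xs ⊆ ys → length xs ≤ length ys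
  Unique⇒length-≤ {[]}     _          _  = z≤n
  Unique⇒length-≤ {x ∷ xs} (x∉ ∷ uxs) xs⊆ys with ∈-∃++ (xs⊆ys (here refl))
  ... | as , bs , refl = subst (suc (length xs) ≤_) (sym (length-++-sucʳ as x bs))
    (s≤s (Unique⇒length-≤ uxs (λ v∈xs → skip as (xs⊆ys (there v∈xs)) (All.lookup x∉ v∈xs ∘ sym))))
    where
      skip : ∀ as {v bs} → v ∈ as ++ x ∷ bs → v ≢ x → v ∈ as ++ bs
      skip []       (here v≡x) v≢x = ⊥-elim (v≢x v≡x)
      skip []       (there v∈) _   = v∈
      skip (a ∷ as) (here v≡a) _   = here v≡a
      skip (a ∷ as) (there v∈) v≢x = there (skip as v∈ v≢x)

  module _ {R : A → A → Set} where

    Linked-++⁻ : ∀ xs {ys} → Linked R (xs ++ ys) → Linked R xs × Linked R ys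
    Linked-++⁻ []           l        = [] , l
    Linked-++⁻ (x ∷ [])     l        = [-] , Linked.tail l
    Linked-++⁻ (x ∷ y ∷ xs) (r ∷ l) with Linked-++⁻ (y ∷ xs) l
    ... | lxs , lys = r ∷ lxs , lys

    Linked-∷ʳ : ∀ xs {e y} → Linked R (xs ∷ʳ e) → R e y → Linked R (xs ∷ʳ e ∷ʳ y)
    Linked-∷ʳ []            [-]      r = r ∷ [-]
    Linked-∷ʳ (x ∷ [])      (r′ ∷ l) r = r′ ∷ Linked-∷ʳ [] l r
    Linked-∷ʳ (x ∷ x′ ∷ xs) (r′ ∷ l) r = r′ ∷ Linked-∷ʳ (x′ ∷ xs) l r

    Linked-glue : ∀ {x} xs {y ys} → Linked R (x ∷ xs) → Linked R (y ∷ ys) → lastOf x xs ≡ y →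
                  Linked R (x ∷ xs ++ ys)
    Linked-glue []       _       l refl = l
    Linked-glue (_ ∷ xs) (r ∷ l) l′ eq  = r ∷ Linked-glue xs l l′ eq

module _ {n : ℕ} (G : Graph n) where
  open Graph G using (edge; irrefl)

  Adj⇒≢ : ∀ {u v} → Adj G u v → u ≢ v
  Adj⇒≢ {u} u~u refl with trans (sym u~u) (irrefl u)
  ... | ()

  IsPath : List (Fin n) → Set
  IsPath xs = Unique xs × Linked (Adj G) xs

  Spans : Lollipop G → List (Fin n) → Set
  Spans L xs = ∀ v → InL G L v ⇔ v ∈ xs

  neighbourCount : Fin n → List (Fin n) → ℕ
  neighbourCount v ws = sum (map (λ w → if edge v w then 1 else 0) ws)

  neighbour-∈ : ∀ v ws → 1 ≤ neighbourCount v ws → ∃ λ y → y ∈ ws × Adj G v y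
  neighbour-∈ v (w ∷ ws) count with edge v w in v~w
  ... | true  = w , here refl , v~w
  ... | false with neighbour-∈ v ws count
  ...   | y , y∈ws , v~y = y , there y∈ws , v~y

  neighbour-≢ : ∀ v p ws → Unique ws → 2 ≤ neighbourCount v ws → ∃ λ y → Adj G v y × y ≢ p
  neighbour-≢ v p (w ∷ ws) (w∉ ∷ uws) count with edge v w in v~w
  ... | false = neighbour-≢ v p ws uws count
  ... | true with w ≟ p | count
  ...   | no w≢p | _ = w , v~w , w≢p
  ...   | yes refl | s≤s count′ with neighbour-∈ v ws count′
  ...     | y , y∈ws , v~y = y , v~y , λ where refl → All.lookup w∉ y∈ws refl

  Unique⇒length-≤n : ∀ {xs} → Unique xs → length xs ≤ n
  Unique⇒length-≤n {xs} uxs =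
    subst (length xs ≤_) (length-tabulate {n = n} (λ i → i))
          (Unique⇒length-≤ {ys = allFin n} uxs (λ {v} _ → ∈-allFin v))

  path-∷ʳ : ∀ as y → IsPath (as ∷ʳ y) → Path G
  path-∷ʳ []       y (u , l) = mkPath y [] u l
  path-∷ʳ (a ∷ as) y (u , l) = mkPath a (as ∷ʳ y) u l

  pverts-path-∷ʳ : ∀ as y p → pverts G (path-∷ʳ as y p) ≡ as ∷ʳ y
  pverts-path-∷ʳ []       y p = refl
  pverts-path-∷ʳ (a ∷ as) y p = refl

  pend-path-∷ʳ : ∀ as y p → pend G (path-∷ʳ as y p) ≡ y
  pend-path-∷ʳ []       y p = refl
  pend-path-∷ʳ (a ∷ as) y p = lastOf-++ a as (y ∷ [])

  chord⇒lollipop : ∀ as y bs → IsPath (as ++ y ∷ bs) → 2 ≤ length bs → Adj G (lastOf y bs) y →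
                   Σ (Lollipop G) λ L → cverts G (Lollipop.cycle L) ≡ y ∷ bs × Spans L (as ++ y ∷ bs)
  chord⇒lollipop as y bs (u , l) long closing with Unique-++⁻ as u
  ... | uas , uyb , disjoint = L , refl , spans
    where
      stem : IsPath (as ∷ʳ y)
      stem = Unique-∷ʳ uas (λ y∈as → disjoint (y∈as , here refl))
           , proj₁ (Linked-++⁻ (as ∷ʳ y) (subst (Linked (Adj G)) (sym (∷ʳ-++ as y bs)) l))
      P : Path G
      P = path-∷ʳ as y stem
      C : Cycle G
      C = mkCycle y bs (s≤s long) uyb (proj₂ (Linked-++⁻ as l)) closing
      ∈P⇒∈as∷ʳy : ∀ {v} → v ∈ pverts G P → v ∈ as ∷ʳ y
      ∈P⇒∈as∷ʳy {v} = subst (v ∈_) (pverts-path-∷ʳ as y stem)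
      meet : ∀ v → v ∈ pverts G P → v ∈ y ∷ bs → v ≡ y
      meet v v∈P v∈C with ∈-++⁻ as (∈P⇒∈as∷ʳy v∈P)
      ... | inj₁ v∈as       = ⊥-elim (disjoint (v∈as , v∈C))
      ... | inj₂ (here v≡y) = v≡y
      L : Lollipop G
      L = mkLollipop P C (pend-path-∷ʳ as y stem) meet
      spans : Spans L (as ++ y ∷ bs)
      spans v = mk⇔ into onto
        where
          into : InL G L v → v ∈ as ++ y ∷ bs
          into (inj₁ v∈P) with ∈-++⁻ as (∈P⇒∈as∷ʳy v∈P)
          ... | inj₁ v∈as       = ∈-++⁺ˡ v∈as
          ... | inj₂ (here v≡y) = ∈-++⁺ʳ as (here v≡y)
          into (inj₂ v∈C) = ∈-++⁺ʳ as v∈C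
          onto : v ∈ as ++ y ∷ bs → InL G L v
          onto v∈ with ∈-++⁻ as v∈
          ... | inj₁ v∈as = inj₁ (subst (v ∈_) (sym (pverts-path-∷ʳ as y stem)) (∈-++⁺ˡ v∈as))
          ... | inj₂ v∈C  = inj₂ v∈C

  end-chord⇒lollipop : ∀ ps p e {y} → IsPath (ps ∷ʳ p ∷ʳ e) → y ∈ ps → Adj G e y →
                       Σ (Lollipop G) λ L → ∀ v → v ∈ ps ∷ʳ p ∷ʳ e → InL G L v
  end-chord⇒lollipop ps p e {y} path y∈ps e~y with ∈-∃++ y∈ps
  ... | as , bs , refl =
    let L , _ , spans = chord⇒lollipop as y (bs ∷ʳ p ∷ʳ e) (subst IsPath reassoc path)
                                        (2≤length-∷ʳ-∷ʳ bs p e) closing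
    in  L , λ v → from (spans v) ∘ subst (v ∈_) reassoc
    where
      reassoc : (as ++ y ∷ bs) ∷ʳ p ∷ʳ e ≡ as ++ y ∷ (bs ∷ʳ p ∷ʳ e)
      reassoc = trans (cong (_∷ʳ e) (++-assoc as (y ∷ bs) (p ∷ []))) (++-assoc as (y ∷ bs ∷ʳ p) (e ∷ []))
      closing : Adj G (lastOf y (bs ∷ʳ p ∷ʳ e)) y
      closing = subst (λ z → Adj G z y) (sym (lastOf-++ y (bs ∷ʳ p) (e ∷ []))) e~y

  module _ (minDeg₂ : MinDegreeAtLeast G 2) where

    -- The fuel bounds how often the path can still grow: a path has at most n vertices.
    path⇒lollipop′ : ∀ fuel ps p e → n < length (ps ∷ʳ p ∷ʳ e) + fuel → IsPath (ps ∷ʳ p ∷ʳ e) →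
                     Σ (Lollipop G) λ L → ∀ v → v ∈ ps ∷ʳ p ∷ʳ e → InL G L v
    path⇒lollipop′ 0 ps p e bound (u , _) =
      ⊥-elim (<⇒≱ (subst (n <_) (+-identityʳ _) bound) (Unique⇒length-≤n u))
    path⇒lollipop′ (suc fuel) ps p e bound (u , l) with neighbour-≢ e p (allFin n) (allFin⁺ n) (minDeg₂ e)
    ... | y , e~y , y≢p with any? (y ≟_) ps
    ...   | yes y∈ps = end-chord⇒lollipop ps p e (u , l) y∈ps e~y
    ...   | no y∉ps = map₂ (λ ⊆L v v∈ → ⊆L v (∈-++⁺ˡ v∈))
                           (path⇒lollipop′ fuel (ps ∷ʳ p) e y bound′
                                           (Unique-∷ʳ u y∉path , Linked-∷ʳ (ps ∷ʳ p) l e~y))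
      where
        y∉path : y ∉ ps ∷ʳ p ∷ʳ e
        y∉path y∈ with ∈-++⁻ (ps ∷ʳ p) y∈
        ... | inj₂ (here y≡e) = Adj⇒≢ e~y (sym y≡e)
        ... | inj₁ y∈ps∷ʳp with ∈-++⁻ ps y∈ps∷ʳp
        ...   | inj₁ y∈ps       = y∉ps y∈ps
        ...   | inj₂ (here y≡p) = y≢p y≡p
        bound′ : n < length (ps ∷ʳ p ∷ʳ e ∷ʳ y) + fuel
        bound′ = subst (n <_) (trans (sym (+-assoc (length (ps ∷ʳ p ∷ʳ e)) 1 fuel))
                                     (cong (_+ fuel) (sym (length-++ (ps ∷ʳ p ∷ʳ e))))) bound

    path⇒lollipop : ∀ zs → 2 ≤ length zs → IsPath zs → Σ (Lollipop G) λ L → ∀ v → v ∈ zs → InL G L v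
    path⇒lollipop zs long path with initLast zs
    ... | [] with long
    ...   | ()
    path⇒lollipop zs long path | zs′ ∷ʳ′ e with initLast zs′
    ...   | [] with long
    ...     | s≤s ()
    path⇒lollipop zs long path | zs′ ∷ʳ′ e | ps ∷ʳ′ p = path⇒lollipop′ (suc n) ps p e (m≤n+m (suc n) _) path

  spans⇒SameVerts : ∀ L L′ {xs} → Spans L xs → Spans L′ xs → SameVerts G L L′
  spans⇒SameVerts _ _ spans spans′ = (λ v → from (spans′ v) ∘ to (spans v)) , (λ v → from (spans v) ∘ to (spans′ v))

  module Tour (L : Lollipop G) {u : Fin n}
              (H : HamPathInCycleVerts G (Lollipop.cycle L) (Cycle.first (Lollipop.cycle L)) u) where
    open Lollipop L using (joined; disjoint) renaming (path to P; cycle to C)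
    open HamPathInCycleVerts H

    hs : List (Fin n)
    hs = Path.rest hp

    tour : List (Fin n)
    tour = pverts G P ++ hs

    hp-starts-at-end-of-P : Path.first hp ≡ pend G P
    hp-starts-at-end-of-P = trans starts (sym joined)

    tour-ends-at-u : lastOf (Path.first P) (Path.rest P ++ hs) ≡ u
    tour-ends-at-u = trans (lastOf-++ _ (Path.rest P) hs)
                           (trans (cong (λ z → lastOf z hs) (sym hp-starts-at-end-of-P)) ends)

    tour-isPath : IsPath tour
    tour-isPath = ++⁺ (Path.unique P) (AllPairs.tail (Path.unique hp)) P∩hs≡∅
                , Linked-glue (Path.rest P) (Path.linked P) (Path.linked hp) (sym hp-starts-at-end-of-P)
      where
        P∩hs≡∅ : Disjoint (pverts G P) hs
        P∩hs≡∅ {v} (v∈P , v∈hs) = Unique[x∷xs]⇒x∉xs (Path.unique hp)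
          (subst (_∈ hs) (trans (disjoint v v∈P (inside v (there v∈hs))) (sym starts)) v∈hs)

    tour-spans : Spans L tour
    tour-spans v = mk⇔ into onto
      where
        into : InL G L v → v ∈ tour
        into (inj₁ v∈P) = ∈-++⁺ˡ v∈P
        into (inj₂ v∈C) with covers v v∈C
        ... | here v≡h₀ = ∈-++⁺ˡ (subst (_∈ pverts G P) (sym (trans v≡h₀ hp-starts-at-end-of-P))
                                        (lastOf-∈ (Path.first P) (Path.rest P)))
        ... | there v∈hs = ∈-++⁺ʳ (pverts G P) v∈hs
        onto : v ∈ tour → InL G L v
        onto v∈ with ∈-++⁻ (pverts G P) v∈
        ... | inj₁ v∈P  = inj₁ v∈P
        ... | inj₂ v∈hs = inj₂ (inside v (there v∈hs))

    hs-long : 2 ≤ length hs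
    hs-long = s≤s⁻¹ (≤-trans (Cycle.long C) (Unique⇒length-≤ (Cycle.unique C) (λ {v} → covers v)))

    longer-cycle : ∀ {w} → w ∈ pverts G P → w ∉ cverts G C → Adj G u w →
                   Σ (Lollipop G) λ L′ → SameVerts G L L′ × clength G C < clength G (Lollipop.cycle L′)
    longer-cycle {w} w∈P w∉C u~w with ∈-∃++ w∈P
    ... | as , bs , P≡ =
      let L′ , C′≡ , spans′ = chord⇒lollipop as w (bs ++ hs) (subst IsPath tour≡ tour-isPath)
                                             (≤-trans hs-long (length-++-≤ʳ hs {bs})) closing
      in  L′ , spans⇒SameVerts L L′ tour-spans (subst (Spans L′) (sym tour≡) spans′)
             , subst (λ zs → clength G C < length zs) (sym C′≡) longer
      where
        tour≡ : tour ≡ as ++ w ∷ (bs ++ hs)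
        tour≡ = trans (cong (_++ hs) P≡) (++-assoc as (w ∷ bs) hs)
        closing : Adj G (lastOf w (bs ++ hs)) w
        closing = subst (λ z → Adj G z w) (trans (sym tour-ends-at-u) (lastOf-cong-++ as tour≡)) u~w
        C⊆ : w ∷ cverts G C ⊆ w ∷ bs ++ hs
        C⊆ (here v≡w) = here v≡w
        C⊆ {v} (there v∈C) with covers v v∈C
        ... | here v≡h₀ = ∈-++⁺ˡ (subst (_∈ w ∷ bs)
                                        (sym (trans v≡h₀ (trans hp-starts-at-end-of-P (lastOf-cong-++ as P≡))))
                                        (lastOf-∈ w bs))
        ... | there v∈hs = there (∈-++⁺ʳ bs v∈hs)
        longer : clength G C < length (w ∷ bs ++ hs)
        longer = Unique⇒length-≤ (¬Any⇒All¬ (cverts G C) w∉C ∷ Cycle.unique C) C⊆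

    larger-lollipop : MinDegreeAtLeast G 2 → ∀ {w} → ¬ InL G L w → Adj G u w →
                      Σ (Lollipop G) λ L′ → StrictSub G L L′
    larger-lollipop minDeg₂ {w} w∉L u~w =
      let L′ , ⊆L′ = path⇒lollipop minDeg₂ (tour ∷ʳ w)
                                   (s≤s (length-++-≤ʳ (w ∷ []) {Path.rest P ++ hs})) extended
      in  L′ , (λ v → ⊆L′ v ∘ ∈-++⁺ˡ ∘ to (tour-spans v)) , w , ⊆L′ w (∈-++⁺ʳ tour (here refl)) , w∉L
      where
        extended : IsPath (tour ∷ʳ w)
        extended = Unique-∷ʳ (proj₁ tour-isPath) (w∉L ∘ from (tour-spans w))
                 , Linked-glue (Path.rest P ++ hs) (proj₂ tour-isPath) (u~w ∷ [-]) tour-ends-at-u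

lemma2 : (n k : ℕ) → 2 ≤ k → (G : Graph n) → MinDegreeAtLeast G k →
         (L : Lollipop G) → Optimal G L → (u : Fin n) →
         HamPathInCycleVerts G (Lollipop.cycle L) (Cycle.first (Lollipop.cycle L)) u →
         ∀ w → Adj G u w → w ∈ cverts G (Lollipop.cycle L)
lemma2 n k 2≤k G minDeg L opt u H w u~w
  with any? (w ≟_) (cverts G (Lollipop.cycle L)) | any? (w ≟_) (pverts G (Lollipop.path L))
... | yes w∈C | _ = w∈C
... | no w∉C | yes w∈P =
  let L′ , same , longer = Tour.longer-cycle G L H w∈P w∉C u~w
  in  ⊥-elim (Optimal.longest opt L′ same longer)
... | no w∉C | no w∉P =
  let L′ , larger = Tour.larger-lollipop G L H (λ v → ≤-trans 2≤k (minDeg v)) [ w∉P , w∉C ] u~w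
  in  ⊥-elim (Optimal.maximal opt L′ larger)
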